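{- Let $\Gamma,\Gamma^{ - },\Gamma^{+}$ be environments and $L,L^{ - },L^{+}$ linear types such that $(\Gamma^{ - },L^{ - })\le^-_1(\Gamma,L)$ and $(\Gamma^{+},L^{+})\le^+_1(\Gamma,L)$. Then there exist an environment $\Gamma^{\pm}$ and a linear type $L^{\pm}$ such that $(\Gamma^{\pm},L^{\pm})\le^+_1(\Gamma^{ - },L^{ - })$ and $(\Gamma^{\pm},L^{\pm})\le^-_1(\Gamma^{+},L^{+})$.
   Context: Types: linear $L ::= X\mid M\to_cL$ ($X$ atoms, $c\in\{\circ,\bullet\}$); multi $M ::= [L_1,\ldots,L_n]$ (finite multisets). Environments map variables to multi types with finite support. Polarized whitening $\le^a_k$ ($a\in\{+,-\}$, $\bar a$ opposite), on linear and multi types by mutual induction: $X\le^a_0X$; if $M'\le^-_{k_1}M$, $L'\le^+_{k_2}L$ then $(M'\to_\circ L')\le^+_{k_1+k_2+1}(M\to_\bullet L)$; for any $c$, if $M'\le^{\bar a}_{k_1}M$, $L'\le^a_{k_2}L$ then $(M'\to_cL')\le^a_{k_1+k_2}(M\to_cL)$; $[L'_1,\ldots,L'_n]\le^a_{\sum k_i}[L_1,\ldots,L_n]$ when $L'_i\le^a_{k_i}L_i$; no other rules. Environments: $\Gamma'\le^a_k\Gamma$ iff $\Gamma'(x)\le^a_{k_x}\Gamma(x)$ for all $x$ with $\sum_xk_x=k$. Pairs: $(\Gamma',L')\le^a_{k_1+k_2}(\Gamma,L)$ iff $\Gamma'\le^{\bar a}_{k_1}\Gamma$ and $L'\le^a_{k_2}L$.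 -}

module Defs where

open import Data.Nat using (ℕ; zero; suc; _+_)
open import Data.List using (List; []; _∷_; map)
open import Data.Nat.ListAction using (sum)
open import Data.List.Membership.Propositional using (_∈_; _∉_)
open import Data.List.Relation.Unary.Unique.Propositional using (Unique)
open import Data.List.Relation.Binary.Permutation.Propositional using (_↭_)
open import Data.Product using (Σ; ∃; _×_; _,_)
open import Relation.Binary.PropositionalEquality using (_≡_)

data Colour : Set where
  white black : Colour

data Pol : Set where
  pos neg : Pol

opp : Pol → Pol
opp pos = neg
opp neg = pos

-- Linear types over a set of atoms; multi types are finite multisets,
-- represented by lists (taken up to permutation, see the multi rule below).
mutual
  data Lin (Atom : Set) : Set where
    atom : Atom → Lin Atom
    arr  : Multi Atom → Colour → Lin Atom → Lin Atom

  Multi : Set → Set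
  Multi Atom = List (Lin Atom)

mutual
  -- L' ≤^a_k L   written  LinW a k L' L
  data LinW {Atom : Set} : Pol → ℕ → Lin Atom → Lin Atom → Set where
    w-atom  : ∀ {a} (X : Atom) → LinW a 0 (atom X) (atom X)
    w-white : ∀ {k₁ k₂ M' M L' L} →
              MultiW neg k₁ M' M → LinW pos k₂ L' L →
              LinW pos (k₁ + k₂ + 1) (arr M' white L') (arr M black L)
    w-arr   : ∀ {a c k₁ k₂ M' M L' L} →
              MultiW (opp a) k₁ M' M → LinW a k₂ L' L →
              LinW a (k₁ + k₂) (arr M' c L') (arr M c L)

  data ListW {Atom : Set} : Pol → ℕ → List (Lin Atom) → List (Lin Atom) → Set where
    []  : ∀ {a} → ListW a 0 [] []
    _∷_ : ∀ {a k₁ k₂ L' L Ls' Ls} →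
          LinW a k₁ L' L → ListW a k₂ Ls' Ls → ListW a (k₁ + k₂) (L' ∷ Ls') (L ∷ Ls)

  -- Multiset version: the enumerations of M' and M may be in any order,
  -- so we allow arbitrary reorderings of both sides.
  data MultiW {Atom : Set} : Pol → ℕ → Multi Atom → Multi Atom → Set where
    mw : ∀ {a k M' M N' N} → M' ↭ N' → M ↭ N → ListW a k N' N → MultiW a k M' M

Var : Set
Var = ℕ

record Env (Atom : Set) : Set where
  field
    _⟨_⟩    : Var → Multi Atom
    support : List Var
    finite  : ∀ x → x ∉ support → _⟨_⟩ x ≡ []
open Env public

-- The sum over all variables is finite: k_x vanishes outside a finite
-- duplicate-free list xs of variables, and k is the sum over xs.
EnvW : {Atom : Set} → Pol → ℕ → Env Atom → Env Atom → Set
EnvW a k Γ' Γ =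
  Σ (Var → ℕ) λ kx →
    (∀ x → MultiW a (kx x) (Γ' ⟨ x ⟩) (Γ ⟨ x ⟩)) ×
    Σ (List Var) λ xs →
      Unique xs × (∀ x → x ∉ xs → kx x ≡ 0) × (sum (map kx xs) ≡ k)

PairW : {Atom : Set} → Pol → ℕ → Env Atom × Lin Atom → Env Atom × Lin Atom → Set
PairW a k (Γ' , L') (Γ , L) =
  Σ ℕ λ k₁ → Σ ℕ λ k₂ →
    EnvW (opp a) k₁ Γ' Γ × LinW a k₂ L' L × (k₁ + k₂ ≡ k)

{-# OPTIONS --safe #-}
module Submission where

-- A whitening ≤⁺ can only turn black arrows white at positive positions of a
-- type, and ≤⁻ only at negative ones.  Two whitenings of opposite polarity of
-- the same type therefore act on disjoint sets of arrows, and performing both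
-- gives a common lower bound that lies one step (of the other polarity, with
-- the other cost) below each.  The multiset rule only requires that pointwise
-- whitening of lists can be transported along a permutation of its
-- right-hand side, and the environment case is the multiset case pointwise.

open import Defs
open import Data.Product using (Σ; _×_; _,_; proj₁; proj₂)
open import Data.Nat.Properties using (+-commutativeSemigroup)
open import Algebra.Properties.CommutativeSemigroup +-commutativeSemigroup
  using (x∙yz≈y∙xz)
open import Data.List using (List; []; _∷_)
open import Data.List.Relation.Binary.Permutation.Propositional
  using (_↭_; refl; prep; swap; trans; ↭-sym)
open import Data.List.Relation.Binary.Permutation.Propositional.Properties
  using (↭-empty-inv)
open import Relation.Binary.PropositionalEquality as ≡ using (_≡_; subst)

ListW-swap : ∀ {Atom : Set} {a k} {A' B' A B : Lin Atom} {Ls' Ls : List (Lin Atom)} →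
  ListW a k (A' ∷ B' ∷ Ls') (A ∷ B ∷ Ls) → ListW a k (B' ∷ A' ∷ Ls') (B ∷ A ∷ Ls)
ListW-swap (_∷_ {k₁ = i} h₁ (_∷_ {k₁ = j} {k₂ = k} h₂ w))
  rewrite x∙yz≈y∙xz i j k = h₂ ∷ h₁ ∷ w

ListW-permuteʳ : ∀ {Atom : Set} {a k} {Ls' Ls Ns : List (Lin Atom)} →
  ListW a k Ls' Ls → Ls ↭ Ns →
  Σ (List (Lin Atom)) λ Ns' → Ls' ↭ Ns' × ListW a k Ns' Ns
ListW-permuteʳ w refl = _ , refl , w
ListW-permuteʳ (h ∷ w) (prep _ p) with ListW-permuteʳ w p
... | _ , p' , w' = _ , prep _ p' , h ∷ w'
ListW-permuteʳ (h₁ ∷ h₂ ∷ w) (swap _ _ p) with ListW-permuteʳ w p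
... | _ , p' , w' = _ , swap _ _ p' , ListW-swap (h₁ ∷ h₂ ∷ w')
ListW-permuteʳ w (trans p q) with ListW-permuteʳ w p
... | _ , p₁ , w₁ with ListW-permuteʳ w₁ q
... | _ , p₂ , w₂ = _ , trans p₁ p₂ , w₂

mutual
  LinW-diamond : ∀ {Atom : Set} a {k₁ k₂} {A B L : Lin Atom} →
    LinW a k₁ A L → LinW (opp a) k₂ B L →
    Σ (Lin Atom) λ C → LinW (opp a) k₂ C A × LinW a k₁ C B
  LinW-diamond _ (w-atom X) (w-atom .X) = atom X , w-atom X , w-atom X
  LinW-diamond pos (w-white m l) (w-arr m' l')
    with MultiW-diamond neg m m' | LinW-diamond pos l l'
  ... | M , m₁ , m₂ | L , l₁ , l₂ = arr M white L , w-arr m₁ l₁ , w-white m₂ l₂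
  LinW-diamond pos (w-arr {c = c} m l) (w-arr m' l')
    with MultiW-diamond neg m m' | LinW-diamond pos l l'
  ... | M , m₁ , m₂ | L , l₁ , l₂ = arr M c L , w-arr m₁ l₁ , w-arr m₂ l₂
  LinW-diamond neg (w-arr m l) (w-white m' l')
    with MultiW-diamond pos m m' | LinW-diamond neg l l'
  ... | M , m₁ , m₂ | L , l₁ , l₂ = arr M white L , w-white m₁ l₁ , w-arr m₂ l₂
  LinW-diamond neg (w-arr {c = c} m l) (w-arr m' l')
    with MultiW-diamond pos m m' | LinW-diamond neg l l'
  ... | M , m₁ , m₂ | L , l₁ , l₂ = arr M c L , w-arr m₁ l₁ , w-arr m₂ l₂

  ListW-diamond : ∀ {Atom : Set} a {k₁ k₂} {As Bs Ls : List (Lin Atom)} →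
    ListW a k₁ As Ls → ListW (opp a) k₂ Bs Ls →
    Σ (List (Lin Atom)) λ Cs → ListW (opp a) k₂ Cs As × ListW a k₁ Cs Bs
  ListW-diamond a [] [] = [] , [] , []
  ListW-diamond a (h ∷ w) (h' ∷ w')
    with LinW-diamond a h h' | ListW-diamond a w w'
  ... | C , h₁ , h₂ | Cs , w₁ , w₂ = C ∷ Cs , h₁ ∷ w₁ , h₂ ∷ w₂

  MultiW-diamond : ∀ {Atom : Set} a {k₁ k₂} {A B M : Multi Atom} →
    MultiW a k₁ A M → MultiW (opp a) k₂ B M →
    Σ (Multi Atom) λ C → MultiW (opp a) k₂ C A × MultiW a k₁ C B
  MultiW-diamond a (mw p q w) (mw p' q' w')
    with ListW-permuteʳ w' (trans (↭-sym q') q)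
  ... | _ , r , w'' with ListW-diamond a w w''
  ... | C , w₁ , w₂ = C , mw refl p w₁ , mw refl (trans p' r) w₂

MultiW-empty-inv : ∀ {Atom : Set} {a k} {M : Multi Atom} → MultiW a k M [] → M ≡ []
MultiW-empty-inv (mw p q w) with ≡.refl ← ↭-empty-inv (↭-sym q) | [] ← w =
  ↭-empty-inv p

EnvW-diamond : ∀ {Atom : Set} a {k₁ k₂} {Γ₁ Γ₂ Γ : Env Atom} →
  EnvW a k₁ Γ₁ Γ → EnvW (opp a) k₂ Γ₂ Γ →
  Σ (Env Atom) λ Γ₃ → EnvW (opp a) k₂ Γ₃ Γ₁ × EnvW a k₁ Γ₃ Γ₂
EnvW-diamond {Atom} a {Γ₁ = Γ₁} {Γ₂} (kx , f , xs) (jx , g , ys) =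
  Γ₃ , (jx , (λ x → proj₁ (proj₂ (D x))) , ys) , (kx , (λ x → proj₂ (proj₂ (D x))) , xs)
  where
  D : ∀ x → Σ (Multi Atom) λ C →
    MultiW (opp a) (jx x) C (Γ₁ ⟨ x ⟩) × MultiW a (kx x) C (Γ₂ ⟨ x ⟩)
  D x = MultiW-diamond a (f x) (g x)

  Γ₃ : Env Atom
  Γ₃ = record
    { _⟨_⟩   = λ x → proj₁ (D x)
    ; support = support Γ₂
    ; finite  = λ x x∉ → MultiW-empty-inv
        (subst (MultiW a (kx x) _) (finite Γ₂ x x∉) (proj₂ (proj₂ (D x))))
    }

lemma12 : {Atom : Set} (Γ Γ⁻ Γ⁺ : Env Atom) (L L⁻ L⁺ : Lin Atom) →
    PairW neg 1 (Γ⁻ , L⁻) (Γ , L) →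
    PairW pos 1 (Γ⁺ , L⁺) (Γ , L) →
    Σ (Env Atom) λ Γ± → Σ (Lin Atom) λ L± →
      PairW pos 1 (Γ± , L±) (Γ⁻ , L⁻) × PairW neg 1 (Γ± , L±) (Γ⁺ , L⁺)
lemma12 Γ Γ⁻ Γ⁺ L L⁻ L⁺ (k₁ , k₂ , Γ⁻≤Γ , L⁻≤L , k≡1) (j₁ , j₂ , Γ⁺≤Γ , L⁺≤L , j≡1)
  with EnvW-diamond pos {Γ₁ = Γ⁻} {Γ⁺} {Γ} Γ⁻≤Γ Γ⁺≤Γ | LinW-diamond neg L⁻≤L L⁺≤L
... | Γ± , Γ±≤Γ⁻ , Γ±≤Γ⁺ | L± , L±≤L⁻ , L±≤L⁺ =
  Γ± , L± , (j₁ , j₂ , Γ±≤Γ⁻ , L±≤L⁻ , j≡1) , (k₁ , k₂ , Γ±≤Γ⁺ , L±≤L⁺ , k≡1)
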